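{- Let $r\ge1$ and $c:[\mathbb{N}]^2\to r$. For every $i\in\mathbb{N}$, the set $\mathcal{D}_i$ of conditions $(P_0,\dots,P_{r-1},X)$ such that $i$ appears on some path $P_j$ is dense: every condition is extended by some condition in $\mathcal{D}_i$.
   Context: A path of color $j$ is a finite or infinite list of distinct natural numbers in which every two consecutive elements $a,b$ satisfy $c(\{a,b\})=j$ (empty and one-element lists are paths of every color). For $m\in\mathbb{N}$ and $j<r$, $N(m,j)=\{n : c(\{m,n\})=j\}$. $A\subseteq^*B$ means $A\setminus B$ is finite. A condition is a tuple $(P_0,\dots,P_{r-1},X)$ such that (1) $X\subseteq\mathbb{N}$ is infinite; (2) each $P_j$ is a finite path of color $j$; (3) no integer appears on more than one of the paths; (4) if $P_j$ is nonempty with last element $e_j$, then $X\subseteq^* N(e_j,j)$. A condition $(\widehat P_0,\dots,\widehat P_{r-1},\widehat X)$ extends $(P_0,\dots,P_{r-1},X)$ if for every $j$, $P_j$ is an initial subpath (initial segment) of $\widehat P_j$, and $\widehat X\subseteq X$. -}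

module Defs where

open import Level using (0ℓ)
open import Data.Nat using (ℕ; _≤_; _⊓_; _⊔_)
open import Data.Fin using (Fin)
open import Data.List using (List; last; _++_)
open import Data.Maybe using (just)
open import Data.Product using (Σ; ∃; _×_)
open import Data.List.Membership.Propositional using (_∈_)
open import Data.List.Relation.Unary.Unique.Propositional using (Unique)
open import Data.List.Relation.Unary.Linked using (Linked)
open import Relation.Binary.PropositionalEquality using (_≡_; _≢_)
open import Data.Empty using (⊥)
open import Relation.Unary using (Pred; _⊆_)

-- A colouring c : [ℕ]^2 → r is given by a function `col` on ordered pairs;
-- the colour of the unordered pair {a,b} (a ≠ b) is col (min a b) (max a b).
-- Every colouring of [ℕ]^2 arises this way (diagonal values are irrelevant).
Colouring : ℕ → Set
Colouring r = ℕ → ℕ → Fin r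

pc : ∀ {r} → Colouring r → ℕ → ℕ → Fin r
pc col a b = col (a ⊓ b) (a ⊔ b)

N : ∀ {r} → Colouring r → ℕ → Fin r → Pred ℕ 0ℓ
N col m j n = pc col m n ≡ j

Infinite : Pred ℕ 0ℓ → Set
Infinite X = ∀ n → ∃ λ m → n ≤ m × X m

-- A ⊆* B : A ∖ B is finite, i.e. all elements of A above some bound lie in B
_⊆*_ : Pred ℕ 0ℓ → Pred ℕ 0ℓ → Set
A ⊆* B = ∃ λ b → ∀ n → b ≤ n → A n → B n

IsPath : ∀ {r} → Colouring r → Fin r → List ℕ → Set
IsPath col j P = Unique P × Linked (λ a b → pc col a b ≡ j) P

record Condition {r : ℕ} (col : Colouring r) : Set₁ where
  field
    P : Fin r → List ℕ
    X : Pred ℕ 0ℓ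
    X-inf : Infinite X
    paths : ∀ j → IsPath col j (P j)
    disjoint : ∀ j k n → j ≢ k → n ∈ P j → n ∈ P k → ⊥
    tail-ok : ∀ j e → last (P j) ≡ just e → X ⊆* N col e j

open Condition

_≼_ : ∀ {r} {col : Colouring r} → Condition col → Condition col → Set
Q ≼ C = (∀ j → ∃ λ s → P Q j ≡ P C j ++ s) × (X Q ⊆ X C)

D : ∀ {r} {col : Colouring r} → ℕ → Condition col → Set
D i Q = ∃ λ j → i ∈ P Q j

-- If i already lies on a path there is nothing to do. Otherwise, by the infinite
-- pigeonhole principle some colour j has X ∩ N(i,j) infinite; pick x in it so large
-- that x is on no path, x ≠ i, and x lies beyond the point from which X ⊆ N(e,j) for
-- the last element e of P_j. Appending x, i to P_j gives a path of colour j, and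
-- shrinking X to X ∩ N(i,j) makes the new last element i satisfy clause (4).
module Submission where

open import Defs
open import Level using (0ℓ)
open import Data.Nat using (ℕ; _≤_)
open import Data.Product using (Σ; _×_)
open import Axiom.ExcludedMiddle using (ExcludedMiddle)

open import Axiom.DoubleNegationElimination using (em⇒dne)
open import Data.Nat using (zero; suc; _⊔_; _≟_)
open import Data.Nat.Properties using (≤-trans; m≤m⊔n; m≤n⊔m; >⇒≢; ⊓-comm; ⊔-comm)
open import Data.Empty using (⊥)
open import Data.Fin using (Fin)
import Data.Fin as Fin
open import Data.Fin.Properties using (any?)
open import Data.List using (List; []; _∷_; _++_; last; head)
open import Data.List.Properties using (++-identityʳ)
open import Data.List.Membership.Propositional using (_∈_; _∉_)
open import Data.List.Membership.Propositional.Properties using (∈-++⁻; ∈-++⁺ʳ)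
open import Data.List.Membership.DecPropositional _≟_ using (_∈?_)
open import Data.List.Relation.Binary.Disjoint.Propositional using (Disjoint)
open import Data.List.Relation.Unary.Any using (here; there)
open import Data.List.Relation.Unary.All using ([]; _∷_)
open import Data.List.Relation.Unary.AllPairs using ([]; _∷_)
import Data.List.Relation.Unary.Linked.Properties as Linked
import Data.List.Relation.Unary.Unique.Propositional.Properties as Unique
open import Data.List.Relation.Unary.Linked using ([-]; _∷_)
open import Data.Maybe using (just; nothing)
open import Data.Maybe.Properties using (just-injective)
open import Data.Maybe.Relation.Binary.Connected using (Connected; just; nothing-just)
open import Data.Product using (∃; _,_; proj₁; proj₂)
open import Data.Sum using (_⊎_; inj₁; inj₂)
open import Data.Vec.Functional using (updateAt)
open import Data.Vec.Functional.Properties using (updateAt-updates; updateAt-minimal)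
open import Function using (_∘_)
open import Relation.Binary using (Rel)
open import Relation.Binary.PropositionalEquality using (_≡_; _≢_; refl; sym; trans; subst; cong; cong₂)
open import Relation.Nullary using (¬_; yes; no)
open import Relation.Unary using (Pred; _⊆_; ∁)

open Condition

Eventually : Pred ℕ 0ℓ → Set
Eventually Q = ∃ λ b → ∀ n → b ≤ n → Q n

module _ {Q R : Pred ℕ 0ℓ} where

  eventually-map : Q ⊆ R → Eventually Q → Eventually R
  eventually-map Q⊆R (b , ev) = b , λ n b≤n → Q⊆R (ev n b≤n)

  eventually-× : Eventually Q → Eventually R → Eventually (λ n → Q n × R n)
  eventually-× (b , evQ) (c , evR) =
    b ⊔ c , λ n b⊔c≤n → evQ n (≤-trans (m≤m⊔n b c) b⊔c≤n) , evR n (≤-trans (m≤n⊔m b c) b⊔c≤n)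

eventually-∀ : ∀ {r} {Q : Fin r → Pred ℕ 0ℓ} → (∀ k → Eventually (Q k)) → Eventually (λ n → ∀ k → Q k n)
eventually-∀ {zero} _ = 0 , λ _ _ ()
eventually-∀ {suc r} {Q} ev = eventually-map combine (eventually-× (ev Fin.zero) (eventually-∀ (ev ∘ Fin.suc)))
  where
  combine : ∀ {n} → Q Fin.zero n × (∀ k → Q (Fin.suc k) n) → ∀ k → Q k n
  combine (q , qs) Fin.zero = q
  combine (q , qs) (Fin.suc k) = qs k

eventually-≢ : ∀ a → Eventually (_≢ a)
eventually-≢ a = suc a , λ _ a<n → >⇒≢ a<n

eventually-∉ : ∀ (xs : List ℕ) → Eventually (_∉ xs)
eventually-∉ [] = 0 , λ _ _ ()
eventually-∉ (x ∷ xs) = eventually-map combine (eventually-× (eventually-≢ x) (eventually-∉ xs))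
  where
  combine : ∀ {n} → n ≢ x × n ∉ xs → n ∉ x ∷ xs
  combine (n≢x , _) (here n≡x) = n≢x n≡x
  combine (_ , n∉xs) (there n∈xs) = n∉xs n∈xs

infinite-∩-eventually : ∀ {S Q : Pred ℕ 0ℓ} → Infinite S → Eventually Q → ∃ λ n → S n × Q n
infinite-∩-eventually S-inf (b , ev) =
  let n , b≤n , Sn = S-inf b in n , Sn , ev n b≤n

module _ (em : ExcludedMiddle 0ℓ) where

  ¬infinite⇒eventually-∁ : ∀ {S : Pred ℕ 0ℓ} → ¬ Infinite S → Eventually (∁ S)
  ¬infinite⇒eventually-∁ ¬inf = em⇒dne em λ ¬ev → ¬inf λ n →
    em⇒dne em λ ¬above → ¬ev (n , λ m n≤m Sm → ¬above (m , n≤m , Sm))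

  infinite-pigeonhole : ∀ {r} {S : Pred ℕ 0ℓ} → Infinite S → (f : ℕ → Fin r)
                      → ∃ λ j → Infinite (λ n → S n × f n ≡ j)
  infinite-pigeonhole S-inf f = em⇒dne em λ none →
    let n , Sn , ¬classes = infinite-∩-eventually S-inf
          (eventually-∀ λ j → ¬infinite⇒eventually-∁ λ inf → none (j , inf))
    in ¬classes (f n) (Sn , refl)

last-++-∷ : ∀ {A : Set} (xs : List A) y ys → last (xs ++ y ∷ ys) ≡ last (y ∷ ys)
last-++-∷ [] y ys = refl
last-++-∷ (x ∷ []) y ys = refl
last-++-∷ (x ∷ x′ ∷ xs) y ys = last-++-∷ (x′ ∷ xs) y ys

connected-last : ∀ {R : Rel ℕ 0ℓ} xs {a} → (∀ e → last xs ≡ just e → R e a) → Connected R (last xs) (just a)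
connected-last xs R-last with last xs
... | just e = just (R-last e refl)
... | nothing = nothing-just

module _ {r} (col : Colouring r) where

  pc-sym : ∀ a b → pc col a b ≡ pc col b a
  pc-sym a b = cong₂ col (⊓-comm a b) (⊔-comm a b)

  IsPath-pair : ∀ {j a b} → a ≢ b → pc col a b ≡ j → IsPath col j (a ∷ b ∷ [])
  IsPath-pair a≢b ab≡j = ((a≢b ∷ []) ∷ [] ∷ []) , (ab≡j ∷ [-])

  IsPath-++ : ∀ {j xs ys} → IsPath col j xs → IsPath col j ys → Disjoint xs ys
            → Connected (λ a b → pc col a b ≡ j) (last xs) (head ys) → IsPath col j (xs ++ ys)
  IsPath-++ (xs-uniq , xs-linked) (ys-uniq , ys-linked) xs#ys joint =
    Unique.++⁺ xs-uniq ys-uniq xs#ys , Linked.++⁺ xs-linked joint ys-linked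

module _ {r} {col : Colouring r} where

  ≼-refl : (C : Condition col) → C ≼ C
  ≼-refl C = (λ k → [] , sym (++-identityʳ (P C k))) , λ Xn → Xn

  eventually-beyond-tail : (C : Condition col) (j : Fin r)
    → Eventually (λ n → ∀ e → last (P C j) ≡ just e → X C n → N col e j n)
  eventually-beyond-tail C j with last (P C j) | tail-ok C j
  ... | nothing | _ = 0 , λ _ _ _ ()
  ... | just e | ok with ok e refl
  ...   | b , beyond = b , λ { n b≤n .e refl → beyond n b≤n }

  module Extend (C : Condition col) (j : Fin r) (s : List ℕ) (Y : Pred ℕ 0ℓ)
    (Y-inf : Infinite Y) (Y⊆X : Y ⊆ X C)
    (path : IsPath col j (P C j ++ s))
    (fresh : ∀ k {n} → n ∈ s → n ∉ P C k)
    (tail : ∀ e → last (P C j ++ s) ≡ just e → Y ⊆* N col e j) where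

    P′ : Fin r → List ℕ
    P′ = updateAt (P C) j (_++ s)

    updated : ∀ k → (k ≡ j × P′ k ≡ P C j ++ s) ⊎ (k ≢ j × P′ k ≡ P C k)
    updated k with k Fin.≟ j
    ... | yes refl = inj₁ (refl , updateAt-updates j (P C))
    ... | no k≢j = inj₂ (k≢j , updateAt-minimal k j (P C) k≢j)

    ∈-P′ : ∀ {k n} → n ∈ P′ k → (k ≡ j × n ∈ s) ⊎ n ∈ P C k
    ∈-P′ {k} n∈P′ with updated k
    ... | inj₂ (_ , eq) = inj₂ (subst (_ ∈_) eq n∈P′)
    ... | inj₁ (refl , eq) with ∈-++⁻ (P C j) (subst (_ ∈_) eq n∈P′)
    ...   | inj₁ n∈P = inj₂ n∈P
    ...   | inj₂ n∈s = inj₁ (refl , n∈s)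

    paths′ : ∀ k → IsPath col k (P′ k)
    paths′ k with updated k
    ... | inj₁ (refl , eq) = subst (IsPath col j) (sym eq) path
    ... | inj₂ (_ , eq) = subst (IsPath col k) (sym eq) (paths C k)

    disjoint′ : ∀ k l n → k ≢ l → n ∈ P′ k → n ∈ P′ l → ⊥
    disjoint′ k l n k≢l n∈k n∈l with ∈-P′ n∈k | ∈-P′ n∈l
    ... | inj₁ (refl , _) | inj₁ (refl , _) = k≢l refl
    ... | inj₁ (_ , n∈s) | inj₂ n∈l′ = fresh l n∈s n∈l′
    ... | inj₂ n∈k′ | inj₁ (_ , n∈s) = fresh k n∈s n∈k′
    ... | inj₂ n∈k′ | inj₂ n∈l′ = disjoint C k l n k≢l n∈k′ n∈l′

    tail-ok′ : ∀ k e → last (P′ k) ≡ just e → Y ⊆* N col e k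
    tail-ok′ k e last≡e with updated k
    ... | inj₁ (refl , eq) = tail e (trans (sym (cong last eq)) last≡e)
    ... | inj₂ (_ , eq) with tail-ok C k e (trans (sym (cong last eq)) last≡e)
    ...   | b , beyond = b , λ n b≤n Yn → beyond n b≤n (Y⊆X Yn)

    Q : Condition col
    Q = record { P = P′ ; X = Y ; X-inf = Y-inf ; paths = paths′ ; disjoint = disjoint′ ; tail-ok = tail-ok′ }

    Q≼C : Q ≼ C
    Q≼C = extends , Y⊆X
      where
      extends : ∀ k → ∃ λ t → P′ k ≡ P C k ++ t
      extends k with updated k
      ... | inj₁ (refl , eq) = s , eq
      ... | inj₂ (_ , eq) = [] , trans eq (sym (++-identityʳ (P C k)))

    ∈s⇒D : ∀ {n} → n ∈ s → D n Q
    ∈s⇒D n∈s = j , subst (_ ∈_) (sym (updateAt-updates j (P C))) (∈-++⁺ʳ (P C j) n∈s)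

module _ {r} {col : Colouring r} (C : Condition col) {i : ℕ} {j : Fin r} where

  insert-pair : (i∉C : ∀ k → i ∉ P C k) → Infinite (λ n → X C n × N col i j n)
    → ∀ {x} → X C x × N col i j x → x ≢ i → (∀ k → x ∉ P C k)
    → (∀ e → last (P C j) ≡ just e → X C x → N col e j x)
    → Σ (Condition col) (λ Q → (Q ≼ C) × D i Q)
  insert-pair i∉C Y-inf {x} (x∈X , ix≡j) x≢i x∉C x-joins-tail = E.Q , E.Q≼C , E.∈s⇒D (there (here refl))
    where
    Y : Pred ℕ 0ℓ
    Y n = X C n × N col i j n

    path : IsPath col j (P C j ++ x ∷ i ∷ [])
    path = IsPath-++ col (paths C j) (IsPath-pair col x≢i (trans (pc-sym col x i) ix≡j))
      (λ { (n∈P , here refl) → x∉C j n∈P ; (n∈P , there (here refl)) → i∉C j n∈P })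
      (connected-last (P C j) λ e last≡e → x-joins-tail e last≡e x∈X)

    fresh : ∀ k {n} → n ∈ x ∷ i ∷ [] → n ∉ P C k
    fresh k (here refl) = x∉C k
    fresh k (there (here refl)) = i∉C k

    tail : ∀ e → last (P C j ++ x ∷ i ∷ []) ≡ just e → Y ⊆* N col e j
    tail e last≡e with just-injective (trans (sym (last-++-∷ (P C j) x (i ∷ []))) last≡e)
    ... | refl = 0 , λ _ _ → proj₂

    module E = Extend C j (x ∷ i ∷ []) Y Y-inf proj₁ path fresh tail

lemma2 : ExcludedMiddle 0ℓ → (r : ℕ) → 1 ≤ r → (col : Colouring r) → (i : ℕ)
    → (C : Condition col) → Σ (Condition col) (λ Q → (Q ≼ C) × D i Q)
lemma2 em r _ col i C with any? (λ k → i ∈? P C k)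
... | yes i∈C = C , ≼-refl C , i∈C
... | no i∉C =
  let j , Y-inf = infinite-pigeonhole em (X-inf C) (pc col i)
      x , x∈Y , x≢i , x∉C , x-joins-tail = infinite-∩-eventually Y-inf
        (eventually-× (eventually-≢ i) (eventually-× (eventually-∀ (eventually-∉ ∘ P C)) (eventually-beyond-tail C j)))
  in insert-pair C (λ k i∈P → i∉C (k , i∈P)) Y-inf x∈Y x≢i x∉C x-joins-tail
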